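{- Let $S\subseteq\mathbb{N}^{\mathbb{N}}$. Suppose that for every finite sequence $g\in\mathbb{N}^{<\mathbb{N}}$ there are sequences $g_1,g_2\in\mathbb{N}^{\mathbb{N}}$, both extending $g$, with $g_1\in S$ and $g_2\notin S$. Then $S$ is not guessable.
   Context: $\mathbb{N}^{\mathbb{N}}$ is the set of all sequences $f:\mathbb{N}\to\mathbb{N}$ and $\mathbb{N}^{<\mathbb{N}}$ the set of finite sequences of naturals. A function $G:\mathbb{N}^{<\mathbb{N}}\to\{0,1\}$ guesses $S\subseteq\mathbb{N}^{\mathbb{N}}$ if for every $f:\mathbb{N}\to\mathbb{N}$ there exists $m>0$ such that for all $n>m$, $G(f(0),\ldots,f(n))=1$ if $f\in S$ and $G(f(0),\ldots,f(n))=0$ if $f\notin S$. A set $S$ is guessable if some function guesses it. -}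

module Defs where

open import Data.Nat using (ℕ; suc; _<_; _>_)
open import Data.List using (List; length; applyUpTo)
open import Data.Bool using (Bool; true; false)
open import Data.Product using (Σ; _×_; ∃-syntax)
open import Relation.Nullary using (¬_)
open import Relation.Binary.PropositionalEquality using (_≡_)

Seq : Set
Seq = ℕ → ℕ

initSeg : Seq → ℕ → List ℕ
initSeg f n = applyUpTo f (suc n)

Extends : Seq → List ℕ → Set
Extends h g = applyUpTo h (length g) ≡ g

-- G guesses S (output 1 is encoded as true, 0 as false)
Guesses : (List ℕ → Bool) → (Seq → Set) → Set
Guesses G S =
  (f : Seq) → Σ ℕ λ m → (m > 0) ×
    ((n : ℕ) → n > m →
      (S f → G (initSeg f n) ≡ true) × (¬ S f → G (initSeg f n) ≡ false))

Guessable : (Seq → Set) → Set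
Guessable S = ∃[ G ] Guesses G S

module Submission where

-- Suppose G guesses S.  Every finite
-- sequence extends both to a member and to a non-member of S, so we can
-- build a sequence of approximations h₀, h₁, h₂, … where h_{k+1} extends the
-- first L_k values of h_k and lies in S exactly when k is even.  The prefix
-- length L_{k+1} is chosen past the point from which G has settled on h_{k+1};
-- hence G, fed the first L_{k+1} values of h_{k+1}, answers "k is even".
-- The approximations stabilise pointwise to a limit f that agrees with h_k on
-- its first L_k values, so G fed prefixes of f answers true infinitely often
-- and false infinitely often.  A guess that converges on f cannot do that.

open import Defs
open import Data.Nat using (ℕ; zero; suc; _+_; _<_; _≤_; _≤′_; ≤′-refl; ≤′-step; z≤n; s≤s)
open import Data.Nat.Properties
  using (≤-refl; ≤-trans; ≤⇒≤′; ≤-total; m≤m+n; m≤n+m; n≤1+n)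
open import Data.List using (List; []; _∷_; applyUpTo)
open import Data.List.Properties using (length-applyUpTo)
open import Data.Bool using (Bool; true; false; not)
open import Data.Product using (_×_; ∃-syntax; _,_; proj₁; proj₂)
open import Data.Sum using (inj₁; inj₂)
open import Data.Empty using (⊥)
open import Relation.Nullary using (¬_)
open import Relation.Binary.PropositionalEquality
  using (_≡_; refl; sym; trans; cong; cong₂; subst; module ≡-Reasoning)

Agree : Seq → Seq → ℕ → Set
Agree a b n = ∀ i → i < n → a i ≡ b i

applyUpTo-agree : ∀ (a b : Seq) n → applyUpTo a n ≡ applyUpTo b n → Agree a b n
applyUpTo-agree a b (suc n) eq zero    _         = cong (λ { [] → 0 ; (x ∷ _) → x }) eq
applyUpTo-agree a b (suc n) eq (suc i) (s≤s i<n) =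
  applyUpTo-agree (λ j → a (suc j)) (λ j → b (suc j)) n
    (cong (λ { [] → [] ; (_ ∷ xs) → xs }) eq) i i<n

applyUpTo-cong : ∀ (a b : Seq) n → Agree a b n → applyUpTo a n ≡ applyUpTo b n
applyUpTo-cong a b zero    _     = refl
applyUpTo-cong a b (suc n) agree =
  cong₂ _∷_ (agree 0 (s≤s z≤n))
    (applyUpTo-cong (λ j → a (suc j)) (λ j → b (suc j)) n (λ i i<n → agree (suc i) (s≤s i<n)))

extends-agree : ∀ (a b : Seq) n → Extends a (applyUpTo b n) → Agree a b n
extends-agree a b n ext = applyUpTo-agree a b n
  (subst (λ m → applyUpTo a m ≡ applyUpTo b n) (length-applyUpTo b n) ext)

module Limit (h : ℕ → Seq) (L : ℕ → ℕ)
             (coherent : ∀ k → Agree (h (suc k)) (h k) (L k))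
             (L-step : ∀ k → L k ≤ L (suc k))
             (L-grows : ∀ k → k < L (suc k)) where

  L-mono : ∀ {j k} → j ≤′ k → L j ≤ L k
  L-mono ≤′-refl        = ≤-refl
  L-mono (≤′-step {k} p) = ≤-trans (L-mono p) (L-step k)

  chain-agree : ∀ {j k} → j ≤′ k → Agree (h k) (h j) (L j)
  chain-agree ≤′-refl         i i<L = refl
  chain-agree (≤′-step {k} p) i i<L =
    trans (coherent k i (≤-trans i<L (L-mono p))) (chain-agree p i i<L)

  limit : Seq
  limit i = h (suc i) i

  limit-agree : ∀ k → Agree limit (h k) (L k)
  limit-agree k i i<L with ≤-total (suc i) k
  ... | inj₁ i<k = sym (chain-agree (≤⇒≤′ i<k) i (L-grows i))
  ... | inj₂ k≤i = chain-agree (≤⇒≤′ k≤i) i i<L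

Verdict : (Seq → Set) → Bool → Seq → Set
Verdict S true  h = S h
Verdict S false h = ¬ S h

module Guessing (S : Seq → Set) (G : List ℕ → Bool) (guesses : Guesses G S) where

  threshold : Seq → ℕ
  threshold h = proj₁ (guesses h)

  settled : ∀ {b} h n → threshold h < n → Verdict S b h → G (initSeg h n) ≡ b
  settled {true}  h n m<n v = proj₁ (proj₂ (proj₂ (guesses h)) n m<n) v
  settled {false} h n m<n v = proj₂ (proj₂ (proj₂ (guesses h)) n m<n) v

  -- G cannot output each answer at arbitrarily late prefixes of one sequence:
  -- whether or not f ∈ S, one of the two answers would be wrong past the threshold.
  no-oscillation : ∀ f → (∀ m b → ∃[ n ] (m < n × G (initSeg f n) ≡ b)) → ⊥
  no-oscillation f oscillates = not-not-in (λ f∈S → wrong-answer (verdict-false f∈S))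
    where
      wrong-answer : true ≡ false → ⊥
      wrong-answer ()

      verdict-false : S f → true ≡ false
      verdict-false f∈S with oscillates (threshold f) false
      ... | n , m<n , Gn≡false = trans (sym (settled {true} f n m<n f∈S)) Gn≡false

      not-not-in : ¬ ¬ S f
      not-not-in f∉S with oscillates (threshold f) true
      ... | n , m<n , Gn≡true =
        wrong-answer (trans (sym Gn≡true) (settled {false} f n m<n f∉S))

alternate : ℕ → Bool
alternate zero    = true
alternate (suc k) = not (alternate k)

alternate-hits : ∀ m b → ∃[ k ] (m ≤ k × alternate k ≡ b)
alternate-hits m b with b | alternate m in eq
... | true  | true  = m , ≤-refl , eq
... | false | false = m , ≤-refl , eq
... | true  | false = suc m , n≤1+n m , cong not eq
... | false | true  = suc m , n≤1+n m , cong not eq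

module Diagonal (S : Seq → Set)
  (split : (g : List ℕ) → ∃[ g₁ ] ∃[ g₂ ] (Extends g₁ g × Extends g₂ g × S g₁ × ¬ S g₂))
  (G : List ℕ → Bool) (guesses : Guesses G S) where

  open Guessing S G guesses

  witness : Bool → List ℕ → Seq
  witness true  g = proj₁ (split g)
  witness false g = proj₁ (proj₂ (split g))

  witness-extends : ∀ b g → Extends (witness b g) g
  witness-extends true  g = proj₁ (proj₂ (proj₂ (split g)))
  witness-extends false g = proj₁ (proj₂ (proj₂ (proj₂ (split g))))

  witness-verdict : ∀ b g → Verdict S b (witness b g)
  witness-verdict true  g = proj₁ (proj₂ (proj₂ (proj₂ (proj₂ (split g)))))
  witness-verdict false g = proj₂ (proj₂ (proj₂ (proj₂ (proj₂ (split g)))))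

  -- Stage k consists of the approximation approx k and the length len k of
  -- its prefix that all later stages keep.  The next approximation extends
  -- that prefix with verdict alternate k; its kept prefix reaches past
  -- probe k, a position beyond both k and the threshold of the new sequence.
  next-stage : ℕ → Seq × ℕ → Seq × ℕ
  next-stage k (h , L) = h′ , suc (suc (threshold h′ + L + k))
    where h′ = witness (alternate k) (applyUpTo h L)

  stage : ℕ → Seq × ℕ
  stage zero    = (λ _ → 0) , 0
  stage (suc k) = next-stage k (stage k)

  approx : ℕ → Seq
  approx k = proj₁ (stage k)

  len : ℕ → ℕ
  len k = proj₂ (stage k)

  -- the position at which G is tested; len (suc k) is by definition suc (probe k)
  probe : ℕ → ℕ
  probe k = suc (threshold (approx (suc k)) + len k + k)

  coherent : ∀ k → Agree (approx (suc k)) (approx k) (len k)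
  coherent k = extends-agree (approx (suc k)) (approx k) (len k)
    (witness-extends (alternate k) (applyUpTo (approx k) (len k)))

  len-step : ∀ k → len k ≤ len (suc k)
  len-step k = ≤-trans (≤-trans (m≤n+m (len k) _) (m≤m+n _ k)) (≤-trans (n≤1+n _) (n≤1+n _))

  k<probe : ∀ k → k < probe k
  k<probe k = s≤s (m≤n+m k _)

  threshold<probe : ∀ k → threshold (approx (suc k)) < probe k
  threshold<probe k = s≤s (≤-trans (m≤m+n _ (len k)) (m≤m+n _ k))

  open Limit approx len coherent len-step (λ k → ≤-trans (k<probe k) (n≤1+n _)) public

  guess-at-probe : ∀ k → G (initSeg limit (probe k)) ≡ alternate k
  guess-at-probe k = begin
    G (initSeg limit (probe k))
      ≡⟨ cong G (applyUpTo-cong limit (approx (suc k)) (len (suc k)) (limit-agree (suc k))) ⟩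
    G (initSeg (approx (suc k)) (probe k))
      ≡⟨ settled (approx (suc k)) (probe k) (threshold<probe k)
           (witness-verdict (alternate k) (applyUpTo (approx k) (len k))) ⟩
    alternate k ∎
    where open ≡-Reasoning

  oscillates : ∀ m b → ∃[ n ] (m < n × G (initSeg limit n) ≡ b)
  oscillates m b with alternate-hits m b
  ... | k , m≤k , alt≡b = probe k , ≤-trans (s≤s m≤k) (k<probe k) , trans (guess-at-probe k) alt≡b

theorem1 : (S : Seq → Set) →
    ((g : List ℕ) → ∃[ g₁ ] ∃[ g₂ ] (Extends g₁ g × Extends g₂ g × S g₁ × ¬ S g₂)) →
    ¬ Guessable S
theorem1 S split (G , guesses) = Guessing.no-oscillation S G guesses limit oscillates
  where open Diagonal S split G guesses
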